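{- Let $a \geq 2$, $b = 2$, $c \geq 1$, $d$, $e$, $\mathcal{S}$ be integers with $a+b+c = d+e = n$, $d \geq e$, and $1 \leq \mathcal{S} \leq \lfloor \frac{c+2}{2} \rfloor$, and let $\nu = (a+2, 2^{\mathcal{S}-1}, 1^{c+2-2\mathcal{S}})$. If $(\eta, 0, r) \in \mathcal{J}_d^{+}(\nu)$, then $c_{\eta \, (1)}^{\nu} = 1$.
   Context: $c^{\lambda}_{\mu\,\nu}$ are Littlewood--Richardson coefficients ($s_\mu s_\nu=\sum_\lambda c^\lambda_{\mu\,\nu}s_\lambda$). Let $N=n-b+1$. $\mathbf 1_P$ is $1$ if $P$ holds, else $0$; $\lambda^t$ is the conjugate. $\mathcal N_{\nu\,\eta\,s_1\,s_2}$ is the number of partitions $\kappa$ with $\eta\subseteq\kappa\subseteq\nu$, $\kappa/\eta$ a horizontal strip of size $s_1$, $\nu/\kappa$ a horizontal strip of size $s_2$ (with $\mathcal N_{\nu\,\eta\,-1\,s}=0$). $\operatorname{DH}(L)=\{\lambda\vdash L:\ell(\lambda)\le2\text{ or }(\ell(\lambda)\ge3,\ \lambda_3\le2)\}$. For a partition $\eta$: $\operatorname{tail}(\eta)=(\eta_3,\dots,\eta_{\ell(\eta)})$ if $\ell(\eta)\ge3$, else empty; $u(\eta),v(\eta)$ count parts of $\operatorname{tail}(\eta)$ equal to $2$, resp. $1$. Type I: $\ell(\eta)\ge2$, $\eta_1-\eta_2\le v(\eta)$; type II: $\ell(\eta)\ge2$, $\eta_1-\eta_2>v(\eta)$. $\mathbf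 n_3(\eta)=0,\eta_2,u(\eta)+2$; $\mathbf n_4(\eta)=\eta_1,\eta_1,u(\eta)+v(\eta)+2$; $\mathbf d_1(\eta)=0,v(\eta),\eta_1-\eta_2$; $\mathbf d_2(\eta)=0,u(\eta),\eta_2-2$; $\mathbf e^{[p]}_\eta(c)=c+1,c+1,p-1$ (values for $\ell(\eta)=1$, type I, type II). $\Phi(n_3,n_4,d_1,d_2;e,r)=\mathbf 1_{n_3\le r-d_2-1\le n_4}\mathbf 1_{d_1+2d_2<e<d_1+2d_2+3}+\mathbf 1_{n_3\le r-d_2\le n_4}\mathbf 1_{d_1+2d_2\le e\le d_1+2d_2+3}+\mathbf 1_{n_3\le r-d_2+1\le n_4}\mathbf 1_{d_1+2d_2<e<d_1+2d_2+3}-\mathbf 1_{n_3+d_2+d_1=r}\mathbf 1_{d_1+2d_2+1\le e\le d_1+2d_2+2}$; $\Psi(c,r,t,L)=\mathbf 1_{r-1\le c+1\le L-r}\mathbf 1_{c+1=t}+\mathbf 1_{r\le(c+t+2)/2\le L-r}\mathbf 1_{|c+1-t|\le1}$. For $\eta\vdash L$: $\Xi^{[p]}_\eta(0,c)=\mathbf 1_{\eta=(p,1^{c+1})}$; for $1\le r\le\lfloor L/2\rfloor$, $\Xi^{[p]}_\eta(r,c)=\mathbf 1_{c=0}\mathbf 1_{r=1}$ if $\eta=(L)$; $\mathbf 1_{\eta=(L-r,r)^t}$ if $\eta=(1^L)$; $\Psi(c,r,t,L)$ if $\eta=(h,1^t)\ne(L)$, $h\ge2$, $t\ge1$; $\Phi(\mathbf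 n_3(\eta),\mathbf n_4(\eta),\mathbf d_1(\eta),\mathbf d_2(\eta);\mathbf e^{[p]}_\eta(c),r)$ if $\eta\in\operatorname{DH}(L)$, $\ell(\eta)\ge2$, $\eta_2\ge2$; $0$ otherwise. $\mathcal I^+(\nu)$: triples $(\eta,j,r)$ with $\eta\vdash N$, $\eta\in\operatorname{DH}(N)$, $0\le j\le\lfloor\frac{b-1}2\rfloor$, $0\le r\le\lfloor\frac N2\rfloor$, $\mathcal N_{\nu\,\eta\,j\,b-1-j}>\mathcal N_{\nu\,\eta\,j-1\,b-j}$, $\Xi^{[a]}_\eta(r,c)>0$. $\mathcal J^+_d(\nu)=\{(\eta,j,r)\in\mathcal I^+(\nu):\max(N-r+j,\,r+b-1-j)\le d\le N+b-1-r-j\}$. -}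

module Defs where

open import Data.Bool using (Bool; true; false; _∧_; _∨_; if_then_else_; T)
open import Data.Nat as ℕ using (ℕ; zero; suc; _∸_; _≤ᵇ_; _<ᵇ_; _≡ᵇ_)
open import Data.Nat.Properties as ℕP using ()
open import Data.Integer as ℤ using (ℤ; +_; 0ℤ; 1ℤ)
open import Data.Integer.Properties as ℤP using ()
open import Data.List using (List; []; _∷_; _++_; length; map; concat; concatMap;
  upTo; replicate; drop; filterᵇ; reverse; inits)
open import Data.Bool.ListAction using (and)
open import Data.Nat.ListAction using (sum)
open import Data.List.Properties using (≡-dec)
open import Data.List.Relation.Unary.All using (All)
open import Data.List.Relation.Unary.Linked using (Linked)
open import Data.Product using (_×_; _,_)
open import Data.Sum using (_⊎_)
open import Relation.Nullary using (Dec; yes; no)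
open import Relation.Nullary.Decidable using (⌊_⌋)

nth : {A : Set} → A → List A → ℕ → A
nth d []       _       = d
nth d (x ∷ xs) zero    = x
nth d (x ∷ xs) (suc i) = nth d xs i

-- λ_{i+1} (paper's 1-indexed part), 0 beyond the length.
at : List ℕ → ℕ → ℕ
at = nth 0

IsPartition : List ℕ → Set
IsPartition λ' = All (1 ℕ.≤_) λ' × Linked ℕ._≥_ λ'

_⊢_ : List ℕ → ℕ → Set
λ' ⊢ L = IsPartition λ' × sum λ' ≡ L
  where open import Relation.Binary.PropositionalEquality using (_≡_)

InDH : ℕ → List ℕ → Set
InDH L λ' = λ' ⊢ L × (length λ' ℕ.≤ 2 ⊎ (3 ℕ.≤ length λ' × at λ' 2 ℕ.≤ 2))

conj : List ℕ → List ℕ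
conj λ' = map (λ k → length (filterᵇ (λ x → suc k ≤ᵇ x) λ')) (upTo (at λ' 0))

_=L_ : List ℕ → List ℕ → Bool
xs =L ys = ⌊ ≡-dec ℕP._≟_ xs ys ⌋

decreasingᵇ : List ℕ → Bool
decreasingᵇ []           = true
decreasingᵇ (x ∷ [])     = true
decreasingᵇ (x ∷ y ∷ xs) = (y ≤ᵇ x) ∧ decreasingᵇ (y ∷ xs)

increasingᵇ : List ℕ → Bool
increasingᵇ []           = true
increasingᵇ (x ∷ [])     = true
increasingᵇ (x ∷ y ∷ xs) = (x ≤ᵇ y) ∧ increasingᵇ (y ∷ xs)

all : {A : Set} → (A → Bool) → List A → Bool
all p xs = and (map p xs)

count : ℕ → List ℕ → ℕ
count m xs = length (filterᵇ (m ≡ᵇ_) xs)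

containedᵇ : List ℕ → List ℕ → Bool
containedᵇ λ' μ = all (λ i → at λ' i ≤ᵇ at μ i) (upTo (length λ'))

hstripᵇ : List ℕ → List ℕ → Bool
hstripᵇ λ' μ = containedᵇ λ' μ ∧ all (λ i → at μ (suc i) ≤ᵇ at λ' i) (upTo (length μ))

boxed : List ℕ → List (List ℕ)
boxed []       = [] ∷ []
boxed (x ∷ xs) = concatMap (λ k → map (k ∷_) (boxed xs)) (upTo (suc x))

subPartitions : List ℕ → List (List ℕ)
subPartitions ν = map (filterᵇ (1 ≤ᵇ_)) (filterᵇ decreasingᵇ (boxed ν))

-- 𝒩_{ν η s₁ s₂}: number of partitions κ with η ⊆ κ ⊆ ν,
-- κ/η a horizontal strip of size s₁ and ν/κ a horizontal strip of size s₂.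
-- (For s₁ = -1 there is no such κ, so 𝒩 = 0 as in the paper's convention.)
𝒩 : List ℕ → List ℕ → ℤ → ℤ → ℕ
𝒩 ν η s₁ s₂ = length (filterᵇ ok (subPartitions ν))
  where
  ok : List ℕ → Bool
  ok κ = hstripᵇ η κ ∧ hstripᵇ κ ν
       ∧ ⌊ (+ sum κ) ℤP.≟ (+ sum η) ℤ.+ s₁ ⌋
       ∧ ⌊ (+ sum ν) ℤP.≟ (+ sum κ) ℤ.+ s₂ ⌋

-- Littlewood–Richardson coefficients via the Littlewood–Richardson rule:
-- LR ν μ λ = c^ν_{μ λ} = number of semistandard fillings of ν/μ of content
-- λ whose reverse reading word (rows right-to-left, top to bottom) is a
-- lattice word; 0 if μ ⊄ ν.

words : ℕ → ℕ → List (List ℕ)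
words k zero    = [] ∷ []
words k (suc m) = concatMap (λ x → map (suc x ∷_) (words k m)) (upTo k)

fillings : ℕ → List ℕ → List (List (List ℕ))
fillings k []       = [] ∷ []
fillings k (m ∷ ms) = concatMap (λ w → map (w ∷_) (fillings k ms)) (words k m)

LR : List ℕ → List ℕ → List ℕ → ℕ
LR ν μ λ' = if containedᵇ μ ν then length (filterᵇ good (fillings k rowLens)) else 0
  where
  k = length λ'
  rowLens = map (λ i → at ν i ∸ at μ i) (upTo (length ν))
  entry : List (List ℕ) → ℕ → ℕ → ℕ
  entry t i j = at (nth [] t i) (j ∸ at μ i)
  rowsOK : List (List ℕ) → Bool
  rowsOK t = all increasingᵇ t
  colsOK : List (List ℕ) → Bool
  colsOK t = all (λ i → all (λ j →
       if (at μ i ≤ᵇ j) ∧ (at μ (suc i) ≤ᵇ j)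
       then entry t i j <ᵇ entry t (suc i) j else true)
     (upTo (at ν (suc i)))) (upTo (length ν))
  contentOK : List (List ℕ) → Bool
  contentOK t = all (λ m → count (suc m) (concat t) ≡ᵇ at λ' m) (upTo k)
  latticeOK : List (List ℕ) → Bool
  latticeOK t = all (λ w → all (λ m → count (suc (suc m)) w ≤ᵇ count (suc m) w) (upTo k))
                    (inits (concat (map reverse t)))
  good : List (List ℕ) → Bool
  good t = rowsOK t ∧ colsOK t ∧ contentOK t ∧ latticeOK t

𝟙 : {P : Set} → Dec P → ℤ
𝟙 (yes _) = 1ℤ
𝟙 (no _)  = 0ℤ

𝟙≤≤ : ℤ → ℤ → ℤ → ℤ
𝟙≤≤ x y z = 𝟙 (x ℤP.≤? y) ℤ.* 𝟙 (y ℤP.≤? z)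

𝟙<< : ℤ → ℤ → ℤ → ℤ
𝟙<< x y z = 𝟙 (x ℤP.<? y) ℤ.* 𝟙 (y ℤP.<? z)

Φ : ℤ → ℤ → ℤ → ℤ → ℤ → ℤ → ℤ
Φ n₃ n₄ d₁ d₂ e r =
    𝟙≤≤ n₃ (r ℤ.- d₂ ℤ.- 1ℤ) n₄ ℤ.* 𝟙<< s e (s ℤ.+ + 3)
  ℤ.+ 𝟙≤≤ n₃ (r ℤ.- d₂) n₄ ℤ.* 𝟙≤≤ s e (s ℤ.+ + 3)
  ℤ.+ 𝟙≤≤ n₃ (r ℤ.- d₂ ℤ.+ 1ℤ) n₄ ℤ.* 𝟙<< s e (s ℤ.+ + 3)
  ℤ.- 𝟙 (n₃ ℤ.+ d₂ ℤ.+ d₁ ℤP.≟ r) ℤ.* 𝟙≤≤ (s ℤ.+ 1ℤ) e (s ℤ.+ + 2)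
  where s = d₁ ℤ.+ + 2 ℤ.* d₂

-- Ψ(c,r,t,L); the condition r ≤ (c+t+2)/2 ≤ L-r is written as
-- 2r ≤ c+t+2 ≤ 2(L-r).
Ψ : ℤ → ℤ → ℤ → ℤ → ℤ
Ψ c r t L =
    𝟙≤≤ (r ℤ.- 1ℤ) (c ℤ.+ 1ℤ) (L ℤ.- r) ℤ.* 𝟙 (c ℤ.+ 1ℤ ℤP.≟ t)
  ℤ.+ 𝟙≤≤ (+ 2 ℤ.* r) (c ℤ.+ t ℤ.+ + 2) (+ 2 ℤ.* (L ℤ.- r))
      ℤ.* 𝟙 (ℤ.∣ c ℤ.+ 1ℤ ℤ.- t ∣ ℕP.≤? 1)

tailη : List ℕ → List ℕ
tailη η = drop 2 η

u v : List ℕ → ℕ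
u η = count 2 (tailη η)
v η = count 1 (tailη η)

data EtaType : Set where
  len1 typeI typeII : EtaType

etaType : List ℕ → EtaType
etaType η =
  if length η ≤ᵇ 1 then len1
  else if ⌊ (+ at η 0) ℤ.- (+ at η 1) ℤP.≤? + v η ⌋ then typeI else typeII

select : EtaType → ℤ → ℤ → ℤ → ℤ
select len1   x y z = x
select typeI  x y z = y
select typeII x y z = z

𝐧₃ 𝐧₄ 𝐝₁ 𝐝₂ : List ℕ → ℤ
𝐧₃ η = select (etaType η) 0ℤ (+ at η 1) (+ u η ℤ.+ + 2)
𝐧₄ η = select (etaType η) (+ at η 0) (+ at η 0) (+ u η ℤ.+ + v η ℤ.+ + 2)
𝐝₁ η = select (etaType η) 0ℤ (+ v η) ((+ at η 0) ℤ.- (+ at η 1))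
𝐝₂ η = select (etaType η) 0ℤ (+ u η) ((+ at η 1) ℤ.- + 2)

𝐞 : ℕ → List ℕ → ℕ → ℤ
𝐞 p η c = select (etaType η) (+ c ℤ.+ 1ℤ) (+ c ℤ.+ 1ℤ) (+ p ℤ.- 1ℤ)

isHookᵇ : List ℕ → Bool
isHookᵇ []      = false
isHookᵇ (h ∷ t) = (2 ≤ᵇ h) ∧ (1 ≤ᵇ length t) ∧ (t =L replicate (length t) 1)

dhCaseᵇ : List ℕ → Bool
dhCaseᵇ η = ((length η ≤ᵇ 2) ∨ (at η 2 ≤ᵇ 2)) ∧ (2 ≤ᵇ length η) ∧ (2 ≤ᵇ at η 1)

Ξ : ℕ → List ℕ → ℕ → ℕ → ℤ
Ξ p η zero c = 𝟙 (≡-dec ℕP._≟_ η (p ∷ replicate (suc c) 1))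
Ξ p η (suc r') c =
  if suc r' ≤ᵇ L ℕ./ 2 then body else 0ℤ
  where
  L = sum η
  r = suc r'
  body : ℤ
  body =
    if η =L (L ∷ []) then 𝟙 (c ℕP.≟ 0) ℤ.* 𝟙 (r ℕP.≟ 1)
    else if η =L replicate L 1 then 𝟙 (≡-dec ℕP._≟_ η (conj ((L ∸ r) ∷ r ∷ [])))
    else if isHookᵇ η then Ψ (+ c) (+ r) (+ (length η ∸ 1)) (+ L)
    else if dhCaseᵇ η then Φ (𝐧₃ η) (𝐧₄ η) (𝐝₁ η) (𝐝₂ η) (𝐞 p η c) (+ r)
    else 0ℤ

-- The index sets ℐ⁺(ν) and 𝒥⁺_d(ν), for parameters a, b, c
-- (n = a+b+c, N = n-b+1, and Ξ is taken with p = a).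

ℐ⁺ : (a b c : ℕ) → List ℕ → List ℕ → ℕ → ℕ → Set
ℐ⁺ a b c ν η j r =
    η ⊢ N
  × InDH N η
  × j ℕ.≤ (b ∸ 1) ℕ./ 2
  × r ℕ.≤ N ℕ./ 2
  × 𝒩 ν η (+ j ℤ.- 1ℤ) (+ b ℤ.- + j) ℕ.< 𝒩 ν η (+ j) (+ b ℤ.- 1ℤ ℤ.- + j)
  × 0ℤ ℤ.< Ξ a η r c
  where
  n = a ℕ.+ b ℕ.+ c
  N = n ∸ b ℕ.+ 1

𝒥⁺ : (a b c : ℕ) → ℤ → List ℕ → List ℕ → ℕ → ℕ → Set
𝒥⁺ a b c d ν η j r =
    ℐ⁺ a b c ν η j r
  × ((+ N ℤ.- + r ℤ.+ + j) ℤ.⊔ (+ r ℤ.+ + b ℤ.- 1ℤ ℤ.- + j)) ℤ.≤ d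
  × d ℤ.≤ + N ℤ.+ + b ℤ.- 1ℤ ℤ.- + r ℤ.- + j
  where
  N = a ℕ.+ b ℕ.+ c ∸ b ℕ.+ 1

{-# OPTIONS --safe #-}
-- For j = 0 and b = 2 the defining inequality of ℐ⁺ reads 𝒩_{ν η 0 1} > 𝒩_{ν η -1 2} ≥ 0, so some κ
-- makes κ/η a horizontal strip of size 0 and ν/κ one of size 1.  Then κ = η (containment with equal
-- size), hence ν/η is a single box.  By the Littlewood–Richardson rule c^ν_{η (1)} counts the fillings
-- of that box with the letter 1, and there is exactly one.  No other hypothesis is needed.
module Submission where

open import Defs
open import Data.Nat using (ℕ; _≤_; _+_; _∸_; _*_; _/_)
open import Data.Integer using (ℤ; +_) renaming (_+_ to _+ℤ_; _≤_ to _≤ℤ_)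
open import Data.List using (List; []; _∷_; _++_; replicate)
open import Relation.Binary.PropositionalEquality using (_≡_)

open import Data.Bool using (Bool; true; false; T; _∧_; if_then_else_)
open import Data.Bool.Properties using (T-∧; T-≡)
open import Data.Empty using (⊥-elim)
open import Data.Integer.Properties using (+-injective; _≟_)
open import Data.List using (length; map; concat; inits; upTo; applyUpTo; reverse; filterᵇ; _∷ʳ_)
open import Data.List.Properties using (map-upTo; unfold-reverse)
open import Data.List.Relation.Unary.All.Properties using (all⁺; all⁻; applyUpTo⁺₁; applyUpTo⁻)
open import Data.Nat using (zero; suc; _<_; z≤n; s≤s; _≤ᵇ_; _<ᵇ_; _≡ᵇ_; _<?_)
open import Data.Nat.ListAction using (sum)
open import Data.Nat.Properties
  using (≤-reflexive; ≤-trans; <-≤-trans; n≮n; ≮⇒≥; m≤m+n; m≤n+m; m≤n⇒m≤1+n; m<n⇒0<n; n≤0⇒n≡0;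
         +-mono-≤; +-monoʳ-≤; +-monoˡ-≤; +-cancelˡ-≤; +-cancelʳ-≤; +-cancelˡ-≡; +-identityʳ; +-comm; +-assoc;
         m∸n+n≡m; ≤ᵇ⇒≤; ≤⇒≤ᵇ; +-commutativeSemigroup)
open import Algebra.Properties.CommutativeSemigroup +-commutativeSemigroup using (interchange)
open import Data.Product using (∃; _×_; _,_; proj₁; proj₂; uncurry)
open import Function using (_∘_; id; Equivalence)
open import Relation.Binary.PropositionalEquality
  using (refl; sym; trans; cong; cong₂; subst; module ≡-Reasoning)
open import Relation.Nullary using (yes; no)
open import Relation.Nullary.Decidable using (toWitness; ⌊_⌋)

open Equivalence using (to; from)

filterᵇ-nonempty⇒∃ : ∀ {A : Set} {p : A → Bool} (xs : List A) →
  0 < length (filterᵇ p xs) → ∃ λ x → T (p x)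
filterᵇ-nonempty⇒∃ {p = p} (x ∷ xs) nonempty with p x in px
... | true  = x , subst T (sym px) _
... | false = filterᵇ-nonempty⇒∃ xs nonempty

length-filterᵇ-[x] : ∀ {A : Set} {p : A → Bool} {x : A} → T (p x) → length (filterᵇ p (x ∷ [])) ≡ 1
length-filterᵇ-[x] {p = p} {x} px with p x
... | true = refl

all-upTo⁻ : ∀ (p : ℕ → Bool) n → T (all p (upTo n)) → ∀ {i} → i < n → T (p i)
all-upTo⁻ p n h = applyUpTo⁻ id n (all⁺ p (upTo n) h)

all-upTo⁺ : ∀ (p : ℕ → Bool) n → (∀ {i} → i < n → T (p i)) → T (all p (upTo n))
all-upTo⁺ p n h = all⁻ p (applyUpTo⁺₁ id n h)

reverse-replicate : ∀ {A : Set} n (x : A) → reverse (replicate n x) ≡ replicate n x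
reverse-replicate zero    x = refl
reverse-replicate (suc n) x = begin
  reverse (x ∷ replicate n x)  ≡⟨ unfold-reverse x (replicate n x) ⟩
  reverse (replicate n x) ∷ʳ x ≡⟨ cong (_∷ʳ x) (reverse-replicate n x) ⟩
  replicate n x ∷ʳ x           ≡⟨ replicate-∷ʳ n ⟩
  x ∷ replicate n x            ∎
  where
  open ≡-Reasoning
  replicate-∷ʳ : ∀ m → replicate m x ∷ʳ x ≡ x ∷ replicate m x
  replicate-∷ʳ zero    = refl
  replicate-∷ʳ (suc m) = cong (x ∷_) (replicate-∷ʳ m)

concat-map-replicate : ∀ {A : Set} (x : A) ms → concat (map (λ m → replicate m x) ms) ≡ replicate (sum ms) x
concat-map-replicate x []       = refl
concat-map-replicate x (m ∷ ms) = trans (cong (replicate m x ++_) (concat-map-replicate x ms)) (replicate-++ m)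
  where
  replicate-++ : ∀ k → replicate k x ++ replicate (sum ms) x ≡ replicate (k + sum ms) x
  replicate-++ zero    = refl
  replicate-++ (suc k) = cong (x ∷_) (replicate-++ k)

_⊑_ : List ℕ → List ℕ → Set
μ ⊑ ν = ∀ i → at μ i ≤ at ν i

⊑-trans : ∀ λ' μ ν → λ' ⊑ μ → μ ⊑ ν → λ' ⊑ ν
⊑-trans _ _ _ λ⊑μ μ⊑ν i = ≤-trans (λ⊑μ i) (μ⊑ν i)

HorizontalStrip : List ℕ → List ℕ → Set
HorizontalStrip μ ν = μ ⊑ ν × (∀ i → at ν (suc i) ≤ at μ i)

at-≥length : ∀ xs {i} → length xs ≤ i → at xs i ≡ 0
at-≥length []       _       = refl
at-≥length (x ∷ xs) (s≤s h) = at-≥length xs h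

containedᵇ⇒⊑ : ∀ μ ν → T (containedᵇ μ ν) → μ ⊑ ν
containedᵇ⇒⊑ μ ν h i with i <? length μ
... | yes i<ℓ = ≤ᵇ⇒≤ _ _ (all-upTo⁻ _ (length μ) h i<ℓ)
... | no  i≮ℓ rewrite at-≥length μ (≮⇒≥ i≮ℓ) = z≤n

⊑⇒containedᵇ : ∀ μ ν → μ ⊑ ν → T (containedᵇ μ ν)
⊑⇒containedᵇ μ ν μ⊑ν = all-upTo⁺ _ (length μ) (λ {i} _ → ≤⇒≤ᵇ (μ⊑ν i))

hstripᵇ⇒HorizontalStrip : ∀ μ ν → T (hstripᵇ μ ν) → HorizontalStrip μ ν
hstripᵇ⇒HorizontalStrip μ ν h = containedᵇ⇒⊑ μ ν contained , interlaced
  where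
  contained : T (containedᵇ μ ν)
  contained = proj₁ (to T-∧ h)
  interlaced : ∀ i → at ν (suc i) ≤ at μ i
  interlaced i with i <? length ν
  ... | yes i<ℓ = ≤ᵇ⇒≤ _ _ (all-upTo⁻ _ (length ν) (proj₂ (to T-∧ h)) i<ℓ)
  ... | no  i≮ℓ rewrite at-≥length ν (m≤n⇒m≤1+n (≮⇒≥ i≮ℓ)) = z≤n

at≤sum : ∀ xs i → at xs i ≤ sum xs
at≤sum []       i       = z≤n
at≤sum (x ∷ xs) zero    = m≤m+n x (sum xs)
at≤sum (x ∷ xs) (suc i) = ≤-trans (at≤sum xs i) (m≤n+m (sum xs) x)

⊑⇒sum≤ : ∀ μ ν → μ ⊑ ν → sum μ ≤ sum ν
⊑⇒sum≤ []      ν       μ⊑ν = z≤n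
⊑⇒sum≤ (x ∷ μ) []      μ⊑ν = +-mono-≤ (μ⊑ν 0) (⊑⇒sum≤ μ [] (μ⊑ν ∘ suc))
⊑⇒sum≤ (x ∷ μ) (y ∷ ν) μ⊑ν = +-mono-≤ (μ⊑ν 0) (⊑⇒sum≤ μ ν (μ⊑ν ∘ suc))

⊑∧sum≥⇒⊒ : ∀ μ ν → μ ⊑ ν → sum ν ≤ sum μ → ν ⊑ μ
⊑∧sum≥⇒⊒ []      ν       μ⊑ν ν≤μ i       = ≤-trans (at≤sum ν i) ν≤μ
⊑∧sum≥⇒⊒ (x ∷ μ) []      μ⊑ν ν≤μ i       = z≤n
⊑∧sum≥⇒⊒ (x ∷ μ) (y ∷ ν) μ⊑ν ν≤μ zero    =
  +-cancelʳ-≤ (sum ν) y x (≤-trans ν≤μ (+-monoʳ-≤ x (⊑⇒sum≤ μ ν (μ⊑ν ∘ suc))))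
⊑∧sum≥⇒⊒ (x ∷ μ) (y ∷ ν) μ⊑ν ν≤μ (suc i) =
  ⊑∧sum≥⇒⊒ μ ν (μ⊑ν ∘ suc) (+-cancelˡ-≤ x (sum ν) (sum μ) (≤-trans (+-monoˡ-≤ (sum ν) (μ⊑ν 0)) ν≤μ)) i

skewRowLengths : List ℕ → List ℕ → List ℕ
skewRowLengths μ ν = applyUpTo (λ i → at ν i ∸ at μ i) (length ν)

sum-skewRowLengths : ∀ μ ν → μ ⊑ ν → sum (skewRowLengths μ ν) + sum μ ≡ sum ν
sum-skewRowLengths μ       []      μ⊑ν = n≤0⇒n≡0 (⊑⇒sum≤ μ [] μ⊑ν)
sum-skewRowLengths []      (y ∷ ν) μ⊑ν =
  trans (+-assoc y _ 0) (cong (_+_ y) (sum-skewRowLengths [] ν (μ⊑ν ∘ suc)))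
sum-skewRowLengths (x ∷ μ) (y ∷ ν) μ⊑ν = begin
  (y ∸ x + sum (skewRowLengths μ ν)) + (x + sum μ) ≡⟨ interchange (y ∸ x) _ x (sum μ) ⟩
  (y ∸ x + x) + (sum (skewRowLengths μ ν) + sum μ) ≡⟨ cong₂ _+_ (m∸n+n≡m (μ⊑ν 0)) (sum-skewRowLengths μ ν (μ⊑ν ∘ suc)) ⟩
  y + sum ν                                         ∎
  where open ≡-Reasoning

HorizontalStrip-absorbs-empty : ∀ η κ ν → HorizontalStrip η κ → sum κ ≡ sum η →
  HorizontalStrip κ ν → HorizontalStrip η ν
HorizontalStrip-absorbs-empty η κ ν (η⊑κ , _) |κ|≡|η| (κ⊑ν , ν≼κ) =
  ⊑-trans η κ ν η⊑κ κ⊑ν , λ i → ≤-trans (ν≼κ i) (κ⊑η i)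
  where κ⊑η = ⊑∧sum≥⇒⊒ η κ η⊑κ (≤-reflexive |κ|≡|η|)

𝒩₀₁-positive⇒HorizontalStrip : ∀ ν η → 0 < 𝒩 ν η (+ 0) (+ 1) → HorizontalStrip η ν × sum ν ≡ sum η + 1
𝒩₀₁-positive⇒HorizontalStrip ν η positive
  with κ , okκ ← filterᵇ-nonempty⇒∃ (subPartitions ν) positive
  = extract κ okκ
  where
  extract : ∀ κ → T (hstripᵇ η κ ∧ hstripᵇ κ ν ∧ ⌊ + sum κ ≟ + sum η +ℤ + 0 ⌋ ∧ ⌊ + sum ν ≟ + sum κ +ℤ + 1 ⌋) →
    HorizontalStrip η ν × sum ν ≡ sum η + 1
  extract κ okκ
    with η/κ , rest ← to (T-∧ {hstripᵇ η κ}) okκ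
    with κ/ν , sums ← to (T-∧ {hstripᵇ κ ν}) rest
    with |κ|≡|η|+0 , |ν|≡|κ|+1 ← to (T-∧ {⌊ + sum κ ≟ + sum η +ℤ + 0 ⌋}) sums
    = HorizontalStrip-absorbs-empty η κ ν (hstripᵇ⇒HorizontalStrip η κ η/κ) |κ|≡|η| (hstripᵇ⇒HorizontalStrip κ ν κ/ν)
    , trans |ν|≡|κ| (cong (_+ 1) |κ|≡|η|)
    where
    |κ|≡|η| : sum κ ≡ sum η
    |κ|≡|η| = trans (+-injective (toWitness |κ|≡|η|+0)) (+-identityʳ (sum η))
    |ν|≡|κ| : sum ν ≡ sum κ + 1
    |ν|≡|κ| = +-injective (toWitness |ν|≡|κ|+1)

-- The filling predicate of LR is local to its definition and cannot be named; this copy is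
-- definitionally equal to it and names its conjuncts.
module LittlewoodRichardsonFilling (ν μ λ' : List ℕ) where

  entry : List (List ℕ) → ℕ → ℕ → ℕ
  entry t i j = at (nth [] t i) (j ∸ at μ i)

  rowsWeaklyIncreasingᵇ : List (List ℕ) → Bool
  rowsWeaklyIncreasingᵇ t = all increasingᵇ t

  columnsStrictᵇ : List (List ℕ) → Bool
  columnsStrictᵇ t = all (λ i → all (λ j →
       if (at μ i ≤ᵇ j) ∧ (at μ (suc i) ≤ᵇ j)
       then entry t i j <ᵇ entry t (suc i) j else true)
     (upTo (at ν (suc i)))) (upTo (length ν))

  hasContentᵇ : List (List ℕ) → Bool
  hasContentᵇ t = all (λ m → count (suc m) (concat t) ≡ᵇ at λ' m) (upTo (length λ'))

  latticeᵇ : List (List ℕ) → Bool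
  latticeᵇ t = all (λ w → all (λ m → count (suc (suc m)) w ≤ᵇ count (suc m) w) (upTo (length λ')))
                   (inits (concat (map reverse t)))

  isLRFillingᵇ : List (List ℕ) → Bool
  isLRFillingᵇ t = rowsWeaklyIncreasingᵇ t ∧ columnsStrictᵇ t ∧ hasContentᵇ t ∧ latticeᵇ t

  columnsStrict-horizontalStrip : (∀ i → at ν (suc i) ≤ at μ i) → ∀ t → columnsStrictᵇ t ≡ true
  columnsStrict-horizontalStrip ν≼μ t =
    to T-≡ (all-upTo⁺ _ (length ν) λ {i} _ → all-upTo⁺ _ (at ν (suc i)) (guardFails i))
    where
    guardFails : ∀ i {j} → j < at ν (suc i) →
      T (if (at μ i ≤ᵇ j) ∧ (at μ (suc i) ≤ᵇ j) then entry t i j <ᵇ entry t (suc i) j else true)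
    guardFails i {j} j<ν with at μ i ≤ᵇ j in μ≤j
    ... | false = _
    ... | true  = ⊥-elim (n≮n j (<-≤-trans j<ν (≤-trans (ν≼μ i) (≤ᵇ⇒≤ _ _ (subst T (sym μ≤j) _)))))

onesFilling : List ℕ → List (List ℕ)
onesFilling = map (λ m → replicate m 1)

words-1 : ∀ m → words 1 m ≡ replicate m 1 ∷ []
words-1 zero    = refl
words-1 (suc m) rewrite words-1 m = refl

fillings-1 : ∀ R → fillings 1 R ≡ onesFilling R ∷ []
fillings-1 []      = refl
fillings-1 (m ∷ R) rewrite words-1 m | fillings-1 R = refl

increasing-ones : ∀ k → increasingᵇ (replicate k 1) ≡ true
increasing-ones zero          = refl
increasing-ones (suc zero)    = refl
increasing-ones (suc (suc k)) = increasing-ones (suc k)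

all-increasing-onesFilling : ∀ R → all increasingᵇ (onesFilling R) ≡ true
all-increasing-onesFilling []      = refl
all-increasing-onesFilling (m ∷ R) rewrite increasing-ones m = all-increasing-onesFilling R

map-reverse-onesFilling : ∀ R → map reverse (onesFilling R) ≡ onesFilling R
map-reverse-onesFilling []      = refl
map-reverse-onesFilling (m ∷ R) = cong₂ _∷_ (reverse-replicate m 1) (map-reverse-onesFilling R)

LR-box≡1 : ∀ ν η → HorizontalStrip η ν → sum ν ≡ sum η + 1 → LR ν η (1 ∷ []) ≡ 1
LR-box≡1 ν η (η⊑ν , ν≼η) |ν|≡|η|+1
  rewrite to T-≡ (⊑⇒containedᵇ η ν η⊑ν)
        | map-upTo (λ i → at ν i ∸ at η i) (length ν)
        | fillings-1 (skewRowLengths η ν)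
  = length-filterᵇ-[x] {p = isLRFillingᵇ} {x = t} (from T-≡ isLRFilling)
  where
  open LittlewoodRichardsonFilling ν η (1 ∷ [])
  R = skewRowLengths η ν
  t = onesFilling R
  |R|≡1 : sum R ≡ 1
  |R|≡1 = +-cancelˡ-≡ (sum η) (sum R) 1 (begin
    sum η + sum R ≡⟨ +-comm (sum η) (sum R) ⟩
    sum R + sum η ≡⟨ sum-skewRowLengths η ν η⊑ν ⟩
    sum ν         ≡⟨ |ν|≡|η|+1 ⟩
    sum η + 1     ∎)
    where open ≡-Reasoning
  concat-t : concat t ≡ 1 ∷ []
  concat-t = trans (concat-map-replicate 1 R) (cong (λ k → replicate k 1) |R|≡1)
  isLRFilling : isLRFillingᵇ t ≡ true
  isLRFilling
    rewrite all-increasing-onesFilling R | columnsStrict-horizontalStrip ν≼η t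
          | map-reverse-onesFilling R | concat-t
    = refl

lemma5p3 : (a c S : ℕ) (d e : ℤ) →
    2 ≤ a → 1 ≤ c → d +ℤ e ≡ + (a + 2 + c) → e ≤ℤ d →
    1 ≤ S → S ≤ (c + 2) / 2 →
    (η : List ℕ) (r : ℕ) →
    𝒥⁺ a 2 c d ((a + 2) ∷ replicate (S ∸ 1) 2 ++ replicate (c + 2 ∸ 2 * S) 1) η 0 r →
    LR ((a + 2) ∷ replicate (S ∸ 1) 2 ++ replicate (c + 2 ∸ 2 * S) 1) η (1 ∷ []) ≡ 1
lemma5p3 a c S _ _ _ _ _ _ _ _ η _ ((_ , _ , _ , _ , 𝒩-increases , _) , _) =
  uncurry (LR-box≡1 ν η) (𝒩₀₁-positive⇒HorizontalStrip ν η (m<n⇒0<n 𝒩-increases))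
  where
  ν : List ℕ
  ν = (a + 2) ∷ replicate (S ∸ 1) 2 ++ replicate (c + 2 ∸ 2 * S) 1
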